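{- Let $s,s'\ge1$, let $B=B(s'\omega_1)\otimes B(s\omega_1)$ be of type $A_2$, and let $\mathrm{pr}$ be any promotion operator on $B$. If $v'\otimes v\in B$ contains no letter $3$, then $\mathrm{pr}(v'\otimes v)=\mathfrak{pr}(v')\otimes\mathfrak{pr}(v)$.
   Context: Type $A_2$ over the alphabet $\{1,2,3\}$: $B(s\omega_1)$ is the set of weakly increasing words of length $s$ (one-row tableaux), weight $=$ content $(m_1,m_2,m_3)$. For $i\in\{1,2\}$, $e_i,f_i$ act on $v'\otimes v$ via the concatenated word $v'v$: letters $i$ become ")", letters $i+1$ become "(", pairs "()" are matched successively, $f_i$ changes the letter $i$ of the rightmost unmatched ")" into $i+1$ ($\emptyset$ if none), $e_i$ changes the letter $i+1$ of the leftmost unmatched "(" into $i$ ($\emptyset$ if none). A promotion operator is a map $\mathrm{pr}:B\to B$ with (1) $\mathrm{wt}(b)=(w_1,w_2,w_3)\Rightarrow\mathrm{wt}(\mathrm{pr}(b))=(w_3,w_1,w_2)$; (2) $\mathrm{pr}^3=\mathrm{id}$; (3) $\mathrm{pr}\circ e_1=e_2\circ\mathrm{pr}$ and $\mathrm{pr}\circ f_1=f_2\circ\mathrm{pr}$. On a row $v$, $\mathfrak{pr}(v)$ is obtained by removing the letters $3$, placing that many $0$s at the beginning, and adding $1$ to every letter (this is the jeu-de-taquin promotion for one row). -}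

module Defs where

open import Data.Nat using (ℕ; zero; suc; _+_; _≤_)
open import Data.Nat.Properties using (_≟_)
open import Data.Fin using (Fin; toℕ) renaming (zero to fz; suc to fs; _≤_ to _≤ᶠ_)
open import Data.Vec using (Vec; []; _∷_; _++_; splitAt; toList; _[_]≔_)
open import Data.List as L using (List)
open import Data.Maybe using (Maybe; just; nothing)
import Data.Maybe as M
open import Data.Product using (_×_; _,_; proj₁; proj₂)
open import Data.Unit using (⊤)
open import Relation.Nullary using (yes; no)
open import Relation.Binary.PropositionalEquality using (_≡_)

-- Letters of the alphabet {1,2,3}: Fin 3, with fz = 1, fs fz = 2, fs (fs fz) = 3.
Letter : Set
Letter = Fin 3

l1 l2 l3 : Letter
l1 = fz
l2 = fs fz
l3 = fs (fs fz)

val : Letter → ℕ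
val x = suc (toℕ x)

-- weakly increasing words (one-row tableaux)
data WeaklyIncreasing : {n : ℕ} → Vec Letter n → Set where
  wi-nil  : WeaklyIncreasing []
  wi-one  : ∀ x → WeaklyIncreasing (x ∷ [])
  wi-cons : ∀ {n} x y (ys : Vec Letter n) → x ≤ᶠ y →
            WeaklyIncreasing (y ∷ ys) → WeaklyIncreasing (x ∷ y ∷ ys)

Pair : ℕ → ℕ → Set
Pair s' s = Vec Letter s' × Vec Letter s

-- membership in B = B(s'ω₁) ⊗ B(sω₁)
InB : ∀ {s' s} → Pair s' s → Set
InB (v' , v) = WeaklyIncreasing v' × WeaklyIncreasing v

word : ∀ {s' s} → Pair s' s → Vec Letter (s' + s)
word (v' , v) = v' ++ v

count : ∀ {n} → Letter → Vec Letter n → ℕ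
count a [] = 0
count a (x ∷ xs) with toℕ a ≟ toℕ x
... | yes _ = suc (count a xs)
... | no  _ = count a xs

-- weight = content (m₁, m₂, m₃)
wt : ∀ {s' s} → Pair s' s → ℕ × ℕ × ℕ
wt b = count l1 (word b) , count l2 (word b) , count l3 (word b)

rot : ℕ × ℕ × ℕ → ℕ × ℕ × ℕ
rot (w₁ , w₂ , w₃) = (w₃ , w₁ , w₂)

-- bracket classification for the pair of letters (a = i, b = i+1):
-- letter i is ")", letter i+1 is "(", others ignored
data Br : Set where
  cl op ot : Br

classify : Letter → Letter → Letter → Br
classify a b x with toℕ x ≟ toℕ a
... | yes _ = cl
... | no _ with toℕ x ≟ toℕ b
...   | yes _ = op
...   | no _  = ot

-- position of the rightmost unmatched ")" ; k = number of unmatched "(" to the left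
rightmostUnmatchedClose : ∀ {n} → Letter → Letter → ℕ → Vec Letter n → Maybe (Fin n)
rightmostUnmatchedClose a b k [] = nothing
rightmostUnmatchedClose a b k (x ∷ xs) with classify a b x
rightmostUnmatchedClose a b zero (x ∷ xs) | cl with rightmostUnmatchedClose a b zero xs
... | just p  = just (fs p)
... | nothing = just fz
rightmostUnmatchedClose a b (suc k) (x ∷ xs) | cl = M.map fs (rightmostUnmatchedClose a b k xs)
rightmostUnmatchedClose a b k (x ∷ xs) | op = M.map fs (rightmostUnmatchedClose a b (suc k) xs)
rightmostUnmatchedClose a b k (x ∷ xs) | ot = M.map fs (rightmostUnmatchedClose a b k xs)

-- for a word w: (number of ")" of w unmatched within w ,
--                position of the leftmost unmatched "(" of w)
openScan : ∀ {n} → Letter → Letter → Vec Letter n → ℕ × Maybe (Fin n)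
openScan a b [] = 0 , nothing
openScan a b (x ∷ xs) with classify a b x | openScan a b xs
... | cl | c , r = suc c , M.map fs r
... | op | zero , r = zero , just fz
... | op | suc c , r = c , M.map fs r
... | ot | c , r = c , M.map fs r

leftmostUnmatchedOpen : ∀ {n} → Letter → Letter → Vec Letter n → Maybe (Fin n)
leftmostUnmatchedOpen a b w = proj₂ (openScan a b w)

unword : ∀ {s' s} → Vec Letter (s' + s) → Pair s' s
unword {s'} w with splitAt s' w
... | v' , v , _ = v' , v

fGen : ∀ {s' s} → Letter → Letter → Pair s' s → Maybe (Pair s' s)
fGen a b p = M.map (λ q → unword (word p [ q ]≔ b)) (rightmostUnmatchedClose a b 0 (word p))

eGen : ∀ {s' s} → Letter → Letter → Pair s' s → Maybe (Pair s' s)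
eGen a b p = M.map (λ q → unword (word p [ q ]≔ a)) (leftmostUnmatchedOpen a b (word p))

e₁ f₁ e₂ f₂ : ∀ {s' s} → Pair s' s → Maybe (Pair s' s)
e₁ = eGen l1 l2
f₁ = fGen l1 l2
e₂ = eGen l2 l3
f₂ = fGen l2 l3

-- A promotion operator on B (given as a map on the ambient set of pairs,
-- whose behaviour outside B is irrelevant)
record IsPromotion {s' s : ℕ} (pr : Pair s' s → Pair s' s) : Set where
  field
    closed : ∀ b → InB b → InB (pr b)
    wt-pr  : ∀ b → InB b → wt (pr b) ≡ rot (wt b)
    pr³    : ∀ b → InB b → pr (pr (pr b)) ≡ b
    e-comm : ∀ b → InB b → M.map pr (e₁ b) ≡ e₂ (pr b)
    f-comm : ∀ b → InB b → M.map pr (f₁ b) ≡ f₂ (pr b)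

-- jeu-de-taquin promotion of a row, on words of numeric letters:
-- remove the 3s, put that many 0s at the beginning, add 1 to every letter
removeThrees : List ℕ → List ℕ
removeThrees L.[] = L.[]
removeThrees (x L.∷ xs) with x ≟ 3
... | yes _ = removeThrees xs
... | no  _ = x L.∷ removeThrees xs

countThrees : List ℕ → ℕ
countThrees L.[] = 0
countThrees (x L.∷ xs) with x ≟ 3
... | yes _ = suc (countThrees xs)
... | no  _ = countThrees xs

𝔭𝔯 : List ℕ → List ℕ
𝔭𝔯 w = L.map suc (L.replicate (countThrees w) 0 L.++ removeThrees w)

letters : ∀ {n} → Vec Letter n → List ℕ
letters v = L.map val (toList v)

-- A row without the letter 3 is 1^x 2^(s'-x), so v' ⊗ v is a grid point (x , z) with x ≤ s',
-- z ≤ s. As pr sends weight (w₁ , w₂ , 0) to (0 , w₁ , w₂), its image is a pair of rows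
-- 2^x' 3^(s'-x') ⊗ 2^z' 3^(s-z') with x' + z' = x + z. On both families the bracket rule makes
-- e₁, resp. e₂, act through the same injective partial map eStep of the grid, so the
-- commutation pr ∘ e₁ = e₂ ∘ pr says that (x , z) ↦ (x' , z') commutes with eStep. Descending
-- induction from the points where eStep is undefined (they have z = s, and then x is fixed by
-- x + z) shows that this map is the identity. Finally 𝔭𝔯 (1^x 2^(s'-x)) = 2^x 3^(s'-x).
module Submission where

open import Defs
open import Data.Nat using (ℕ; zero; suc; _+_; _∸_; _≤_; _<_; _≥_; z≤n; s≤s; s≤s⁻¹; pred)
open import Data.Nat.Properties
open import Data.Nat.Induction using (<-wellFounded)
open import Induction.WellFounded using (Acc; acc)
open import Data.Fin using (Fin; toℕ) renaming (zero to fz; suc to fs; _≤_ to _≤ᶠ_)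
import Data.Fin.Properties as Finₚ
import Data.List as L
open import Data.Vec using (Vec; []; _∷_; _++_; splitAt; _[_]≔_)
open import Data.Vec.Relation.Unary.All using (All; _∷_)
open import Data.Maybe using (Maybe; just; nothing)
import Data.Maybe as M
import Data.Maybe.Properties as Mₚ
open import Data.Product using (_×_; _,_; proj₁; proj₂)
open import Data.Empty using (⊥-elim)
open import Function using (_∘_)
open import Relation.Nullary using (yes; no; contradiction)
open import Relation.Binary.PropositionalEquality

m∸n≤1+m∸[1+n] : ∀ m n → m ∸ n ≤ suc (m ∸ suc n)
m∸n≤1+m∸[1+n] zero    zero    = z≤n
m∸n≤1+m∸[1+n] zero    (suc n) = z≤n
m∸n≤1+m∸[1+n] (suc m) zero    = ≤-refl
m∸n≤1+m∸[1+n] (suc m) (suc n) = m∸n≤1+m∸[1+n] m n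

<m∸n⇒n<m : ∀ {m n o} → o < m ∸ n → n < m
<m∸n⇒n<m {o = o} o<m∸n = m∸n≢0⇒n<m (λ eq → n≮0 (subst (o <_) eq o<m∸n))

module Grid (s' s : ℕ) where

  InGrid : ℕ × ℕ → Set
  InGrid (x , z) = x ≤ s' × z ≤ s

  total : ℕ × ℕ → ℕ
  total (x , z) = x + z

  height : ℕ × ℕ → ℕ
  height (x , z) = (s' ∸ x) + (s ∸ z)

  -- (x , z) stands for a^x b^(s'-x) ⊗ a^z b^(s-z), a read as ")" and b as "(": the b's of
  -- the first row are matched by the first z a's of the second, so e raises the first row
  -- while z < s' - x, and the second row otherwise.
  eStep : ℕ × ℕ → Maybe (ℕ × ℕ)
  eStep (x , z) with z <? s' ∸ x | z <? s
  ... | yes _ | _     = just (suc x , z)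
  ... | no _  | yes _ = just (x , suc z)
  ... | no _  | no _  = nothing

  eStep-inGrid : ∀ {p q} → InGrid p → eStep p ≡ just q → InGrid q
  eStep-inGrid {x , z} (x≤s' , z≤s) eq with z <? s' ∸ x | z <? s | eq
  ... | yes z<s'∸x | _       | refl = <m∸n⇒n<m z<s'∸x , z≤s
  ... | no _       | yes z<s | refl = x≤s' , z<s

  eStep-height : ∀ {p q} → InGrid p → eStep p ≡ just q → height q < height p
  eStep-height {x , z} (x≤s' , z≤s) eq with z <? s' ∸ x | z <? s | eq
  ... | yes z<s'∸x | _       | refl = +-monoˡ-< (s ∸ z) (∸-monoʳ-< (n<1+n x) (<m∸n⇒n<m z<s'∸x))
  ... | no _       | yes z<s | refl = +-monoʳ-< (s' ∸ x) (∸-monoʳ-< (n<1+n z) z<s)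

  eStep-nothing : ∀ {p} → InGrid p → eStep p ≡ nothing → proj₂ p ≡ s
  eStep-nothing {x , z} (_ , z≤s) eq with z <? s' ∸ x | z <? s | eq
  ... | no _ | no z≮s | refl = ≤-antisym z≤s (≮⇒≥ z≮s)

  eStep-injective : ∀ {p p' q} → eStep p ≡ just q → eStep p' ≡ just q → p ≡ p'
  eStep-injective {x , z} {x' , z'} eq eq'
    with z <? s' ∸ x | z <? s | eq | z' <? s' ∸ x' | z' <? s | eq'
  ... | yes _      | _     | refl | yes _        | _     | refl = refl
  ... | no _       | yes _ | refl | no _         | yes _ | refl = refl
  ... | yes z<s'∸x | _     | refl | no z'≮s'∸x'  | yes _ | refl =
    contradiction (s≤s⁻¹ (≤-trans z<s'∸x (m∸n≤1+m∸[1+n] s' x))) z'≮s'∸x'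
  ... | no z≮s'∸x  | yes _ | refl | yes z'<s'∸x' | _     | refl =
    contradiction (s≤s⁻¹ (≤-trans z'<s'∸x' (m∸n≤1+m∸[1+n] s' x'))) z≮s'∸x

  proj₂≡∧total≡⇒≡ : ∀ {p q} → proj₂ p ≡ proj₂ q → total p ≡ total q → p ≡ q
  proj₂≡∧total≡⇒≡ {x , z} {x' , .z} refl eq = cong (_, z) (+-cancelʳ-≡ z x x' eq)

  module Equivariant (φ : ℕ × ℕ → ℕ × ℕ)
                     (φ-inGrid : ∀ {p} → InGrid p → InGrid (φ p))
                     (φ-total : ∀ {p} → InGrid p → total (φ p) ≡ total p)
                     (φ-eStep : ∀ {p} → InGrid p → eStep (φ p) ≡ M.map φ (eStep p)) where

    identity-on-grid : ∀ {p} → InGrid p → φ p ≡ p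
    identity-on-grid g = fixes g (<-wellFounded _)
      where
      fixes : ∀ {p} → InGrid p → Acc _<_ (height p) → φ p ≡ p
      fixes {p} g (acc rec) with eStep p in eq
      ... | just q = eStep-injective φp↦q eq
        where
        φq≡q : φ q ≡ q
        φq≡q = fixes (eStep-inGrid g eq) (rec (eStep-height g eq))
        φp↦q : eStep (φ p) ≡ just q
        φp↦q = trans (φ-eStep g) (trans (cong (M.map φ) eq) (cong just φq≡q))
      ... | nothing = proj₂≡∧total≡⇒≡
        (trans (eStep-nothing (φ-inGrid g) φp↦nothing) (sym (eStep-nothing g eq))) (φ-total g)
        where
        φp↦nothing : eStep (φ p) ≡ nothing
        φp↦nothing = trans (φ-eStep g) (cong (M.map φ) eq)

splitAt-++ : ∀ {A : Set} {m n} (u : Vec A m) (t : Vec A n) → splitAt m (u ++ t) ≡ (u , t , refl)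
splitAt-++ []      t = refl
splitAt-++ (x ∷ u) t rewrite splitAt-++ u t = refl

unword-++ : ∀ {m n} (u : Vec Letter m) (t : Vec Letter n) → unword {m} {n} (u ++ t) ≡ (u , t)
unword-++ u t rewrite splitAt-++ u t = refl

module TwoLetterRows (a b : Letter) (a≤b : a ≤ᶠ b)
                     (a-closes : classify a b a ≡ cl) (b-opens : classify a b b ≡ op) where

  row : (n k : ℕ) → Vec Letter n
  row zero    k       = []
  row (suc n) zero    = b ∷ row n zero
  row (suc n) (suc k) = a ∷ row n k

  row-weaklyIncreasing : ∀ n k → WeaklyIncreasing (row n k)
  row-weaklyIncreasing zero          k             = wi-nil
  row-weaklyIncreasing (suc zero)    zero          = wi-one b
  row-weaklyIncreasing (suc zero)    (suc k)       = wi-one a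
  row-weaklyIncreasing (suc (suc n)) zero          =
    wi-cons b b _ (Finₚ.≤-refl {x = b}) (row-weaklyIncreasing (suc n) zero)
  row-weaklyIncreasing (suc (suc n)) (suc zero)    = wi-cons a b _ a≤b (row-weaklyIncreasing (suc n) zero)
  row-weaklyIncreasing (suc (suc n)) (suc (suc k)) =
    wi-cons a a _ (Finₚ.≤-refl {x = a}) (row-weaklyIncreasing (suc n) (suc k))

  unmatchedCloses : ∀ {n} → Vec Letter n → ℕ
  unmatchedCloses w = proj₁ (openScan a b w)

  eWord : ∀ {n} → Vec Letter n → Maybe (Vec Letter n)
  eWord w = M.map (w [_]≔ a) (leftmostUnmatchedOpen a b w)

  eGen≡eWord : ∀ {s' s} (u : Vec Letter s') (t : Vec Letter s) →
               eGen a b (u , t) ≡ M.map unword (eWord (u ++ t))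
  eGen≡eWord u t = Mₚ.map-∘ (leftmostUnmatchedOpen a b (u ++ t))

  openScan-a : ∀ {n} (w : Vec Letter n) →
               openScan a b (a ∷ w) ≡ (suc (unmatchedCloses w) , M.map fs (leftmostUnmatchedOpen a b w))
  openScan-a w rewrite a-closes = refl

  openScan-b-unmatched : ∀ {n} (w : Vec Letter n) → unmatchedCloses w ≡ 0 → openScan a b (b ∷ w) ≡ (0 , just fz)
  openScan-b-unmatched w eq rewrite b-opens with openScan a b w | eq
  ... | .0 , _ | refl = refl

  openScan-b-matched : ∀ {n} (w : Vec Letter n) {c} → unmatchedCloses w ≡ suc c →
                       openScan a b (b ∷ w) ≡ (c , M.map fs (leftmostUnmatchedOpen a b w))
  openScan-b-matched w eq rewrite b-opens with openScan a b w | eq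
  ... | .(suc _) , _ | refl = refl

  unmatchedCloses-a : ∀ {n} (w : Vec Letter n) → unmatchedCloses (a ∷ w) ≡ suc (unmatchedCloses w)
  unmatchedCloses-a w = cong proj₁ (openScan-a w)

  unmatchedCloses-b : ∀ {n} (w : Vec Letter n) → unmatchedCloses (b ∷ w) ≡ pred (unmatchedCloses w)
  unmatchedCloses-b w with unmatchedCloses w in eq
  ... | zero  = cong proj₁ (openScan-b-unmatched w eq)
  ... | suc _ = cong proj₁ (openScan-b-matched w eq)

  private
    map-under-∷ : ∀ {n} x (w : Vec Letter n) (r : Maybe (Fin n)) →
                  M.map ((x ∷ w) [_]≔ a) (M.map fs r) ≡ M.map (x ∷_) (M.map (w [_]≔ a) r)
    map-under-∷ x w (just q) = refl
    map-under-∷ x w nothing  = refl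

  eWord-a : ∀ {n} (w : Vec Letter n) → eWord (a ∷ w) ≡ M.map (a ∷_) (eWord w)
  eWord-a w = trans (cong (M.map ((a ∷ w) [_]≔ a) ∘ proj₂) (openScan-a w))
                    (map-under-∷ a w (leftmostUnmatchedOpen a b w))

  eWord-b-matched : ∀ {n} (w : Vec Letter n) → 0 < unmatchedCloses w →
                    eWord (b ∷ w) ≡ M.map (b ∷_) (eWord w)
  eWord-b-matched w _ with unmatchedCloses w in eq
  ... | suc _ = trans (cong (M.map ((b ∷ w) [_]≔ a) ∘ proj₂) (openScan-b-matched w eq))
                      (map-under-∷ b w (leftmostUnmatchedOpen a b w))

  eWord-b-unmatched : ∀ {n} (w : Vec Letter n) → unmatchedCloses w ≡ 0 → eWord (b ∷ w) ≡ just (a ∷ w)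
  eWord-b-unmatched w eq = cong (M.map ((b ∷ w) [_]≔ a) ∘ proj₂) (openScan-b-unmatched w eq)

  unmatchedCloses-row : ∀ {n k} → k ≤ n → unmatchedCloses (row n k) ≡ k
  unmatchedCloses-row {zero}  z≤n       = refl
  unmatchedCloses-row {suc n} z≤n       = trans (unmatchedCloses-b (row n 0)) (cong pred (unmatchedCloses-row {n} z≤n))
  unmatchedCloses-row {suc n} (s≤s k≤n) = trans (unmatchedCloses-a (row n _)) (cong suc (unmatchedCloses-row k≤n))

  unmatchedCloses-row-++ : ∀ {n k m} (t : Vec Letter m) → k ≤ n →
                           unmatchedCloses (row n k ++ t) ≡ k + (unmatchedCloses t ∸ (n ∸ k))
  unmatchedCloses-row-++ {zero}  t z≤n       = refl
  unmatchedCloses-row-++ {suc n} t z≤n       = begin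
    unmatchedCloses (b ∷ row n 0 ++ t)    ≡⟨ unmatchedCloses-b (row n 0 ++ t) ⟩
    pred (unmatchedCloses (row n 0 ++ t)) ≡⟨ cong pred (unmatchedCloses-row-++ {n} t z≤n) ⟩
    pred (unmatchedCloses t ∸ n)          ≡⟨ pred[m∸n]≡m∸[1+n] (unmatchedCloses t) n ⟩
    unmatchedCloses t ∸ suc n             ∎
    where open ≡-Reasoning
  unmatchedCloses-row-++ {suc n} t (s≤s k≤n) =
    trans (unmatchedCloses-a (row n _ ++ t)) (cong suc (unmatchedCloses-row-++ t k≤n))

  eWord-row-full : ∀ n → eWord (row n n) ≡ nothing
  eWord-row-full zero    = refl
  eWord-row-full (suc n) = trans (eWord-a (row n n)) (cong (M.map (a ∷_)) (eWord-row-full n))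

  eWord-row-< : ∀ {n k} → k < n → eWord (row n k) ≡ just (row n (suc k))
  eWord-row-< {suc n} {zero}  _         = eWord-b-unmatched (row n 0) (unmatchedCloses-row {n} z≤n)
  eWord-row-< {suc n} {suc k} (s≤s k<n) =
    trans (eWord-a (row n k)) (cong (M.map (a ∷_)) (eWord-row-< k<n))

  eWord-row-++ˡ : ∀ {n k m} (t : Vec Letter m) → k ≤ n → unmatchedCloses t < n ∸ k →
                            eWord (row n k ++ t) ≡ just (row n (suc k) ++ t)
  eWord-row-++ˡ {suc n} {zero}  t _ (s≤s c≤n) =
    eWord-b-unmatched (row n 0 ++ t) (trans (unmatchedCloses-row-++ {n} t z≤n) (m≤n⇒m∸n≡0 c≤n))
  eWord-row-++ˡ {suc n} {suc k} t (s≤s k≤n) c<n∸k =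
    trans (eWord-a (row n k ++ t)) (cong (M.map (a ∷_)) (eWord-row-++ˡ t k≤n c<n∸k))

  eWord-row-++ʳ : ∀ {n k m} (t : Vec Letter m) → k ≤ n → n ∸ k ≤ unmatchedCloses t →
                             eWord (row n k ++ t) ≡ M.map (row n k ++_) (eWord t)
  eWord-row-++ʳ {zero}          t z≤n _   = sym (Mₚ.map-id (eWord t))
  eWord-row-++ʳ {suc n} {zero}  t z≤n n<c = begin
    eWord (b ∷ row n 0 ++ t)                     ≡⟨ eWord-b-matched (row n 0 ++ t) 0<c∸n ⟩
    M.map (b ∷_) (eWord (row n 0 ++ t))          ≡⟨ cong (M.map (b ∷_)) (eWord-row-++ʳ t z≤n (<⇒≤ n<c)) ⟩
    M.map (b ∷_) (M.map (row n 0 ++_) (eWord t)) ≡⟨ Mₚ.map-∘ (eWord t) ⟨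
    M.map (row (suc n) 0 ++_) (eWord t)          ∎
    where
    open ≡-Reasoning
    0<c∸n : 0 < unmatchedCloses (row n 0 ++ t)
    0<c∸n = subst (0 <_) (sym (unmatchedCloses-row-++ {n} t z≤n)) (m<n⇒0<n∸m n<c)
  eWord-row-++ʳ {suc n} {suc k} t (s≤s k≤n) h = begin
    eWord (a ∷ row n k ++ t)                     ≡⟨ eWord-a (row n k ++ t) ⟩
    M.map (a ∷_) (eWord (row n k ++ t))          ≡⟨ cong (M.map (a ∷_)) (eWord-row-++ʳ t k≤n h) ⟩
    M.map (a ∷_) (M.map (row n k ++_) (eWord t)) ≡⟨ Mₚ.map-∘ (eWord t) ⟨
    M.map (row (suc n) (suc k) ++_) (eWord t)    ∎
    where open ≡-Reasoning

  rows : ∀ {s' s} → ℕ × ℕ → Pair s' s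
  rows p = row _ (proj₁ p) , row _ (proj₂ p)

  eGen-rows-first : ∀ {s' s x z} → x ≤ s' → z ≤ s → z < s' ∸ x →
                    eGen a b (row s' x , row s z) ≡ just (row s' (suc x) , row s z)
  eGen-rows-first {s'} {s} {x} {z} x≤s' z≤s z<s'∸x = begin
    eGen a b (row s' x , row s z)              ≡⟨ eGen≡eWord (row s' x) (row s z) ⟩
    M.map unword (eWord (row s' x ++ row s z)) ≡⟨ cong (M.map unword) (eWord-row-++ˡ (row s z) x≤s' c<s'∸x) ⟩
    just (unword (row s' (suc x) ++ row s z))  ≡⟨ cong just (unword-++ (row s' (suc x)) (row s z)) ⟩
    just (row s' (suc x) , row s z)            ∎
    where
    open ≡-Reasoning
    c<s'∸x : unmatchedCloses (row s z) < s' ∸ x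
    c<s'∸x = subst (_< s' ∸ x) (sym (unmatchedCloses-row z≤s)) z<s'∸x

  eGen-rows-second : ∀ {s' s x z} → x ≤ s' → z ≤ s → s' ∸ x ≤ z →
                     eGen a b (row s' x , row s z) ≡ M.map (row s' x ,_) (eWord (row s z))
  eGen-rows-second {s'} {s} {x} {z} x≤s' z≤s s'∸x≤z = begin
    eGen a b (row s' x , row s z)                         ≡⟨ eGen≡eWord (row s' x) (row s z) ⟩
    M.map unword (eWord (row s' x ++ row s z))            ≡⟨ cong (M.map unword) (eWord-row-++ʳ (row s z) x≤s' s'∸x≤c) ⟩
    M.map unword (M.map (row s' x ++_) (eWord (row s z))) ≡⟨ Mₚ.map-∘ (eWord (row s z)) ⟨
    M.map (unword ∘ (row s' x ++_)) (eWord (row s z))     ≡⟨ Mₚ.map-cong (unword-++ (row s' x)) (eWord (row s z)) ⟩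
    M.map (row s' x ,_) (eWord (row s z))                 ∎
    where
    open ≡-Reasoning
    s'∸x≤c : s' ∸ x ≤ unmatchedCloses (row s z)
    s'∸x≤c = subst (s' ∸ x ≤_) (sym (unmatchedCloses-row z≤s)) s'∸x≤z

  eGen-rows : ∀ {s' s p} → Grid.InGrid s' s p → eGen a b (rows p) ≡ M.map rows (Grid.eStep s' s p)
  eGen-rows {s'} {s} {x , z} (x≤s' , z≤s) with z <? s' ∸ x | z <? s
  ... | yes z<s'∸x | _       = eGen-rows-first x≤s' z≤s z<s'∸x
  ... | no z≮s'∸x  | yes z<s =
    trans (eGen-rows-second x≤s' z≤s (≮⇒≥ z≮s'∸x)) (cong (M.map (row s' x ,_)) (eWord-row-< z<s))
  ... | no z≮s'∸x  | no z≮s  =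
    trans (eGen-rows-second x≤s' z≤s (≮⇒≥ z≮s'∸x)) (cong (M.map (row s' x ,_)) eWord-top)
    where
    eWord-top : eWord (row s z) ≡ nothing
    eWord-top = trans (cong (eWord ∘ row s) (≤-antisym z≤s (≮⇒≥ z≮s))) (eWord-row-full s)

module Rows₁₂ = TwoLetterRows l1 l2 z≤n refl refl
module Rows₂₃ = TwoLetterRows l2 l3 (s≤s z≤n) refl refl

row₁₂ row₂₃ : (n k : ℕ) → Vec Letter n
row₁₂ = Rows₁₂.row
row₂₃ = Rows₂₃.row

count-≤ : ∀ c {n} (v : Vec Letter n) → count c v ≤ n
count-≤ c []      = z≤n
count-≤ c (x ∷ v) with toℕ c ≟ toℕ x
... | yes _ = s≤s (count-≤ c v)
... | no  _ = m≤n⇒m≤1+n (count-≤ c v)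

count-++ : ∀ c {m n} (u : Vec Letter m) (t : Vec Letter n) → count c (u ++ t) ≡ count c u + count c t
count-++ c []      t = refl
count-++ c (x ∷ u) t with toℕ c ≟ toℕ x
... | yes _ = cong suc (count-++ c u t)
... | no  _ = count-++ c u t

count-l1-row₁₂ : ∀ {n k} → k ≤ n → count l1 (row₁₂ n k) ≡ k
count-l1-row₁₂ {zero}  z≤n       = refl
count-l1-row₁₂ {suc n} z≤n       = count-l1-row₁₂ {n} z≤n
count-l1-row₁₂ {suc n} (s≤s k≤n) = cong suc (count-l1-row₁₂ k≤n)

count-l3-row₁₂ : ∀ n k → count l3 (row₁₂ n k) ≡ 0
count-l3-row₁₂ zero    k       = refl
count-l3-row₁₂ (suc n) zero    = count-l3-row₁₂ n zero
count-l3-row₁₂ (suc n) (suc k) = count-l3-row₁₂ n k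

count-l2-row₂₃ : ∀ {n k} → k ≤ n → count l2 (row₂₃ n k) ≡ k
count-l2-row₂₃ {zero}  z≤n       = refl
count-l2-row₂₃ {suc n} z≤n       = count-l2-row₂₃ {n} z≤n
count-l2-row₂₃ {suc n} (s≤s k≤n) = cong suc (count-l2-row₂₃ k≤n)

row-without-3 : ∀ {n} {v : Vec Letter n} → WeaklyIncreasing v → All (_≢ l3) v → v ≡ row₁₂ n (count l1 v)
row-without-3 wi-nil                                _             = refl
row-without-3 (wi-one fz)                           _             = refl
row-without-3 (wi-one (fs fz))                      _             = refl
row-without-3 (wi-one (fs (fs fz)))                 (x≢3 ∷ _)     = ⊥-elim (x≢3 refl)
row-without-3 (wi-cons fz _ _ _ w)                  (_ ∷ ≢3)      = cong (l1 ∷_) (row-without-3 w ≢3)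
row-without-3 (wi-cons (fs fz) fz _ () _)           _
row-without-3 (wi-cons (fs fz) (fs (fs fz)) _ _ _)  (_ ∷ y≢3 ∷ _) = ⊥-elim (y≢3 refl)
row-without-3 (wi-cons (fs (fs fz)) _ _ _ _)        (x≢3 ∷ _)     = ⊥-elim (x≢3 refl)
row-without-3 (wi-cons (fs fz) (fs fz) ys _ w)      (_ ∷ ≢3)
  with count l1 ys | row-without-3 w ≢3
... | zero | eq = cong (l2 ∷_) eq

row-without-1 : ∀ {n} {v : Vec Letter n} → WeaklyIncreasing v → count l1 v ≡ 0 → v ≡ row₂₃ n (count l2 v)
row-without-1 wi-nil                                     _   = refl
row-without-1 (wi-one (fs fz))                           _   = refl
row-without-1 (wi-one (fs (fs fz)))                      _   = refl
row-without-1 (wi-cons (fs fz) _ _ _ w)                  no1 = cong (l2 ∷_) (row-without-1 w no1)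
row-without-1 (wi-cons (fs (fs fz)) (fs fz) _ (s≤s ()) _) _
row-without-1 (wi-cons (fs (fs fz)) (fs (fs fz)) ys _ w) no1
  with count l2 ys | row-without-1 w no1
... | zero | eq = cong (l3 ∷_) eq

countThrees-row₁₂ : ∀ n k → countThrees (letters (row₁₂ n k)) ≡ 0
countThrees-row₁₂ zero    k       = refl
countThrees-row₁₂ (suc n) zero    = countThrees-row₁₂ n zero
countThrees-row₁₂ (suc n) (suc k) = countThrees-row₁₂ n k

map-suc-removeThrees-row₁₂ : ∀ n k → L.map suc (removeThrees (letters (row₁₂ n k))) ≡ letters (row₂₃ n k)
map-suc-removeThrees-row₁₂ zero    k       = refl
map-suc-removeThrees-row₁₂ (suc n) zero    = cong (3 L.∷_) (map-suc-removeThrees-row₁₂ n zero)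
map-suc-removeThrees-row₁₂ (suc n) (suc k) = cong (2 L.∷_) (map-suc-removeThrees-row₁₂ n k)

letters-row₂₃ : ∀ n k → letters (row₂₃ n k) ≡ 𝔭𝔯 (letters (row₁₂ n k))
letters-row₂₃ n k rewrite countThrees-row₁₂ n k = sym (map-suc-removeThrees-row₁₂ n k)

module PromotionOnRows {s' s : ℕ} (pr : Pair s' s → Pair s' s) (isPromotion : IsPromotion pr) where
  open IsPromotion isPromotion
  open Grid s' s

  rows₁₂ rows₂₃ : ℕ × ℕ → Pair s' s
  rows₁₂ = Rows₁₂.rows
  rows₂₃ = Rows₂₃.rows

  decode : Pair s' s → ℕ × ℕ
  decode (u , v) = count l2 u , count l2 v

  index : ℕ × ℕ → ℕ × ℕ
  index = decode ∘ pr ∘ rows₁₂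

  rows₁₂-inB : ∀ p → InB (rows₁₂ p)
  rows₁₂-inB p = Rows₁₂.row-weaklyIncreasing s' (proj₁ p) , Rows₁₂.row-weaklyIncreasing s (proj₂ p)

  count-l1-rows₁₂ : ∀ {p} → InGrid p → count l1 (word (rows₁₂ p)) ≡ total p
  count-l1-rows₁₂ {x , z} (x≤s' , z≤s) =
    trans (count-++ l1 (row₁₂ s' x) (row₁₂ s z)) (cong₂ _+_ (count-l1-row₁₂ x≤s') (count-l1-row₁₂ z≤s))

  count-l1-pr-rows₁₂ : ∀ p → count l1 (proj₁ (pr (rows₁₂ p))) + count l1 (proj₂ (pr (rows₁₂ p))) ≡ 0
  count-l1-pr-rows₁₂ p@(x , z) = begin
    count l1 (proj₁ (pr (rows₁₂ p))) + count l1 (proj₂ (pr (rows₁₂ p))) ≡⟨ count-++ l1 (proj₁ (pr (rows₁₂ p))) _ ⟨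
    count l1 (word (pr (rows₁₂ p)))                                      ≡⟨ cong proj₁ (wt-pr _ (rows₁₂-inB p)) ⟩
    count l3 (word (rows₁₂ p))                                           ≡⟨ count-++ l3 (row₁₂ s' x) (row₁₂ s z) ⟩
    count l3 (row₁₂ s' x) + count l3 (row₁₂ s z)                         ≡⟨ cong₂ _+_ (count-l3-row₁₂ s' x) (count-l3-row₁₂ s z) ⟩
    0                                                                    ∎
    where open ≡-Reasoning

  pr-rows₁₂ : ∀ p → pr (rows₁₂ p) ≡ rows₂₃ (index p)
  pr-rows₁₂ p =
    cong₂ _,_ (row-without-1 (proj₁ inB) (m+n≡0⇒m≡0 _ no1)) (row-without-1 (proj₂ inB) (m+n≡0⇒n≡0 _ no1))
    where
    inB : InB (pr (rows₁₂ p))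
    inB = closed _ (rows₁₂-inB p)
    no1 : count l1 (proj₁ (pr (rows₁₂ p))) + count l1 (proj₂ (pr (rows₁₂ p))) ≡ 0
    no1 = count-l1-pr-rows₁₂ p

  decode-rows₂₃ : ∀ {q} → InGrid q → decode (rows₂₃ q) ≡ q
  decode-rows₂₃ (x≤s' , z≤s) = cong₂ _,_ (count-l2-row₂₃ x≤s') (count-l2-row₂₃ z≤s)

  decode-rows₂₃-eStep : ∀ {q} → InGrid q → M.map decode (M.map rows₂₃ (eStep q)) ≡ eStep q
  decode-rows₂₃-eStep {q} g with eStep q in eq
  ... | just _ = cong just (decode-rows₂₃ (eStep-inGrid g eq))
  ... | nothing = refl

  index-inGrid : ∀ {p} → InGrid p → InGrid (index p)
  index-inGrid {p} _ = count-≤ l2 (proj₁ (pr (rows₁₂ p))) , count-≤ l2 (proj₂ (pr (rows₁₂ p)))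

  index-total : ∀ {p} → InGrid p → total (index p) ≡ total p
  index-total {p} g = begin
    total (index p)                 ≡⟨ count-++ l2 (proj₁ (pr (rows₁₂ p))) _ ⟨
    count l2 (word (pr (rows₁₂ p))) ≡⟨ cong (proj₁ ∘ proj₂) (wt-pr _ (rows₁₂-inB p)) ⟩
    count l1 (word (rows₁₂ p))      ≡⟨ count-l1-rows₁₂ g ⟩
    total p                         ∎
    where open ≡-Reasoning

  index-eStep : ∀ {p} → InGrid p → eStep (index p) ≡ M.map index (eStep p)
  index-eStep {p} g = begin
    eStep (index p)                                        ≡⟨ decode-rows₂₃-eStep (index-inGrid g) ⟨
    M.map decode (M.map rows₂₃ (eStep (index p)))          ≡⟨ cong (M.map decode) (Rows₂₃.eGen-rows (index-inGrid g)) ⟨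
    M.map decode (e₂ (rows₂₃ (index p)))                   ≡⟨ cong (M.map decode ∘ e₂) (pr-rows₁₂ p) ⟨
    M.map decode (e₂ (pr (rows₁₂ p)))                      ≡⟨ cong (M.map decode) (e-comm _ (rows₁₂-inB p)) ⟨
    M.map decode (M.map pr (e₁ (rows₁₂ p)))                ≡⟨ cong (M.map decode ∘ M.map pr) (Rows₁₂.eGen-rows g) ⟩
    M.map decode (M.map pr (M.map rows₁₂ (eStep p)))       ≡⟨ cong (M.map decode) (Mₚ.map-∘ (eStep p)) ⟨
    M.map decode (M.map (pr ∘ rows₁₂) (eStep p))           ≡⟨ Mₚ.map-∘ (eStep p) ⟨
    M.map index (eStep p)                                  ∎
    where open ≡-Reasoning

  pr-rows₁₂≡rows₂₃ : ∀ {p} → InGrid p → pr (rows₁₂ p) ≡ rows₂₃ p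
  pr-rows₁₂≡rows₂₃ {p} g = trans (pr-rows₁₂ p) (cong rows₂₃ (identity-on-grid g))
    where open Equivariant index index-inGrid index-total index-eStep

lemma4p2 : (s' s : ℕ) → s' ≥ 1 → s ≥ 1 →
    (pr : Pair s' s → Pair s' s) → IsPromotion pr →
    (v' : _) (v : _) → InB {s'} {s} (v' , v) →
    All (λ x → x ≢ l3) v' → All (λ x → x ≢ l3) v →
    (letters (proj₁ (pr (v' , v))) ≡ 𝔭𝔯 (letters v'))
    × (letters (proj₂ (pr (v' , v))) ≡ 𝔭𝔯 (letters v))
lemma4p2 s' s _ _ pr isPromotion v' v (wi' , wi) no3' no3 =
  trans (cong (letters ∘ proj₁) pr≡) (trans (letters-row₂₃ s' x) (cong (𝔭𝔯 ∘ letters) (sym v'≡))) ,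
  trans (cong (letters ∘ proj₂) pr≡) (trans (letters-row₂₃ s z) (cong (𝔭𝔯 ∘ letters) (sym v≡)))
  where
  open PromotionOnRows pr isPromotion
  x z : ℕ
  x = count l1 v'
  z = count l1 v
  v'≡ : v' ≡ row₁₂ s' x
  v'≡ = row-without-3 wi' no3'
  v≡ : v ≡ row₁₂ s z
  v≡ = row-without-3 wi no3
  pr≡ : pr (v' , v) ≡ rows₂₃ (x , z)
  pr≡ = trans (cong pr (cong₂ _,_ v'≡ v≡)) (pr-rows₁₂≡rows₂₃ (count-≤ l1 v' , count-≤ l1 v))
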